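{- Let $N\geq 1$, let $m=(m_1,\dots,m_N)$ and $n_1,\dots,n_N$ be positive integers, and suppose the polynomial $A(x)=\prod_{i=1}^N\frac{x^{m_in_i}-1}{x^{m_i}-1}$ has all coefficients in $\{0,1\}$, so that $A(x)=\sum_{a\in A}x^a$ for a finite set $A\subset\{0,1,2,\dots\}$. Let $\pi:\mathbf{R}^N\to\mathbf{R}$, $\pi(u)=\langle u,m\rangle=u_1m_1+\dots+u_Nm_N$, let $\mathcal{A}=\{(j_1,\dots,j_N)\in\mathbf{Z}^N:\ 0\leq j_k\leq n_k-1\text{ for all }k\}$, and let $W=\{w\in\mathbf{Z}^N:\ \langle w,m\rangle=0\}$. Suppose $B\subset\mathbf{Z}$ is such that every integer can be uniquely written as $a+b$ with $a\in A$, $b\in B$, and let $\mathcal{B}=\{u\in\mathbf{Z}^N:\ \langle u,m\rangle\in B\}$. Then (i) every $w\in\mathbf{Z}^N$ can be uniquely written as $w=u+v$ with $u\in\mathcal{A}$, $v\in\mathcal{B}$; and (ii) $\mathcal{B}+w=\mathcal{B}$ for every $w\in W$.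
   Context: Note that $\pi(\mathcal{A})=A$ and, since the coefficients of $A(x)$ are $0$ or $1$, $\pi$ is injective on $\mathcal{A}$. -}

module Defs where

open import Data.Nat as ℕ using (ℕ; zero; suc)
open import Data.Integer as ℤ using (ℤ; +_)
open import Data.Fin using (Fin; zero; suc)
open import Data.List using (List; []; _∷_; map; replicate; _++_)
open import Data.Product using (_×_)
open import Relation.Binary.PropositionalEquality using (_≡_)

-- Polynomials with ℕ coefficients, as coefficient lists (constant term first).
Poly : Set
Poly = List ℕ

_⊕_ : Poly → Poly → Poly
[] ⊕ q = q
(c ∷ p) ⊕ [] = c ∷ p
(c ∷ p) ⊕ (d ∷ q) = (c ℕ.+ d) ∷ (p ⊕ q)

_⊛_ : Poly → Poly → Poly
[] ⊛ q = []
(c ∷ p) ⊛ q = map (c ℕ.*_) q ⊕ (0 ∷ (p ⊛ q))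

monomial : ℕ → Poly
monomial k = replicate k 0 ++ (1 ∷ [])

-- (x^{m n} - 1)/(x^m - 1) = 1 + x^m + x^{2m} + ... + x^{m(n-1)}
geomPoly : ℕ → ℕ → Poly
geomPoly m zero = []
geomPoly m (suc n) = geomPoly m n ⊕ monomial (m ℕ.* n)

APoly : (N : ℕ) → (Fin N → ℕ) → (Fin N → ℕ) → Poly
APoly zero m n = 1 ∷ []
APoly (suc N) m n = geomPoly (m zero) (n zero) ⊛ APoly N (λ i → m (suc i)) (λ i → n (suc i))

coeff : Poly → ℕ → ℕ
coeff [] a = 0
coeff (c ∷ p) zero = c
coeff (c ∷ p) (suc a) = coeff p a

dot : (N : ℕ) → (Fin N → ℤ) → (Fin N → ℕ) → ℤ
dot zero u m = + 0
dot (suc N) u m = u zero ℤ.* (+ m zero) ℤ.+ dot N (λ i → u (suc i)) (λ i → m (suc i))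

inA : (N : ℕ) → (Fin N → ℕ) → (Fin N → ℕ) → ℤ → Set
inA N m n z = Data.Product.Σ ℕ (λ a → (z ≡ + a) × (coeff (APoly N m n) a ≡ 1))

inCalA : (N : ℕ) → (Fin N → ℕ) → (Fin N → ℤ) → Set
inCalA N n j = (k : Fin N) → (+ 0 ℤ.≤ j k) × (j k ℤ.< + n k)

inCalB : (N : ℕ) → (Fin N → ℕ) → (ℤ → Set) → (Fin N → ℤ) → Set
inCalB N m B u = B (dot N u m)

inW : (N : ℕ) → (Fin N → ℕ) → (Fin N → ℤ) → Set
inW N m w = dot N w m ≡ + 0

{-# OPTIONS --safe #-}
-- Expanding A(x) = ∏ᵢ ∑_{t < nᵢ} x^{mᵢ t}, the exponents that occur are exactly the values
-- π j = ⟨j, m⟩ with j ∈ 𝒜, and an exponent reached from two different j would get a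
-- coefficient ≥ 2; so π is a bijection 𝒜 → A. The tiling A ⊕ B = ℤ then lifts along the
-- additive map π: w = u + (w − u) where π u ∈ A is the A-part of π w, uniqueness comes from
-- injectivity of π on 𝒜, and π (u + w) = π u for w ∈ W.
module Submission where

open import Defs
open import Data.Nat
  using (ℕ; zero; suc; _≤_; _<_; _*_; z≤n; s≤s; s≤s⁻¹; pred; NonZero; >-nonZero; >-nonZero⁻¹)
import Data.Nat as ℕ
open import Data.Nat.Properties
  using (≤-refl; ≤-reflexive; ≤-trans; ≤-antisym; <-irrefl; <-cmp; m≤m+n; m≤n+m; m≤n⇒m<n∨m≡n;
         m≤n⇒m≤1+n; +-identityʳ; *-zeroʳ; *-identityˡ; *-comm; +-monoʳ-≤; +-mono-≤; *-mono-≤;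
         +-cancelˡ-≡; *-cancelˡ-≡; m*n≢0⇒m≢0; m*n≢0⇒n≢0; module ≤-Reasoning)
open import Data.Integer using (ℤ; _+_)
import Data.Integer as ℤ
import Data.Integer.Properties as ℤ
open import Algebra.Properties.AbelianGroup ℤ.+-0-abelianGroup using (∙-cancelˡ; \\-leftDividesˡ)
open import Algebra.Properties.CommutativeSemigroup ℤ.+-commutativeSemigroup using (interchange)
open import Data.Fin using (Fin; zero; suc)
open import Data.List using ([]; _∷_; map)
open import Data.Vec.Functional using (head; tail)
import Data.Vec.Functional as Vector
open import Data.Product using (Σ; _×_; _,_; proj₁; proj₂)
open import Data.Sum using (_⊎_; inj₁; inj₂)
open import Data.Empty using (⊥-elim)
open import Function using (_∘_)
open import Relation.Binary.Definitions using (tri<; tri≈; tri>)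
open import Relation.Binary.PropositionalEquality
  using (_≡_; refl; sym; trans; cong; cong₂; subst; module ≡-Reasoning)

1≤m+n⇒1≤m⊎1≤n : ∀ m {n} → 1 ≤ m ℕ.+ n → 1 ≤ m ⊎ 1 ≤ n
1≤m+n⇒1≤m⊎1≤n zero    1≤n = inj₂ 1≤n
1≤m+n⇒1≤m⊎1≤n (suc m) _   = inj₁ (s≤s z≤n)

1≤m*n⇒1≤m×1≤n : ∀ m n → 1 ≤ m * n → 1 ≤ m × 1 ≤ n
1≤m*n⇒1≤m×1≤n m n 1≤m*n = >-nonZero⁻¹ m {{m*n≢0⇒m≢0 m}} , >-nonZero⁻¹ n {{m*n≢0⇒n≢0 m}}
  where
  instance
    m*n≢0 : NonZero (m * n)
    m*n≢0 = >-nonZero 1≤m*n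

infix 4 _∈supp_

_∈supp_ : ℕ → Poly → Set
i ∈supp p = 1 ≤ coeff p i

CoeffsAtMostOne : Poly → Set
CoeffsAtMostOne p = ∀ a → coeff p a ≤ 1

coeff-⊕ : ∀ p q a → coeff (p ⊕ q) a ≡ coeff p a ℕ.+ coeff q a
coeff-⊕ []      q       a       = refl
coeff-⊕ (c ∷ p) []      a       = sym (+-identityʳ _)
coeff-⊕ (c ∷ p) (d ∷ q) zero    = refl
coeff-⊕ (c ∷ p) (d ∷ q) (suc a) = coeff-⊕ p q a

coeff-map-* : ∀ c q a → coeff (map (c *_) q) a ≡ c * coeff q a
coeff-map-* c []      a       = sym (*-zeroʳ c)
coeff-map-* c (d ∷ q) zero    = refl
coeff-map-* c (d ∷ q) (suc a) = coeff-map-* c q a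

coeff-∷-⊛ : ∀ c p q a → coeff ((c ∷ p) ⊛ q) a ≡ c * coeff q a ℕ.+ coeff (0 ∷ p ⊛ q) a
coeff-∷-⊛ c p q a =
  trans (coeff-⊕ (map (c *_) q) (0 ∷ p ⊛ q) a) (cong (ℕ._+ _) (coeff-map-* c q a))

coeff*coeff≤coeff-⊛ : ∀ p q i k → coeff p i * coeff q k ≤ coeff (p ⊛ q) (i ℕ.+ k)
coeff*coeff≤coeff-⊛ []      q i       k = z≤n
coeff*coeff≤coeff-⊛ (c ∷ p) q zero    k rewrite coeff-∷-⊛ c p q k = m≤m+n _ _
coeff*coeff≤coeff-⊛ (c ∷ p) q (suc i) k rewrite coeff-∷-⊛ c p q (suc i ℕ.+ k) =
  ≤-trans (coeff*coeff≤coeff-⊛ p q i k) (m≤n+m _ _)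

coeff*coeff+coeff*coeff≤coeff-⊛ : ∀ p q {i k i′ k′} → i < i′ → i ℕ.+ k ≡ i′ ℕ.+ k′ →
  coeff p i * coeff q k ℕ.+ coeff p i′ * coeff q k′ ≤ coeff (p ⊛ q) (i ℕ.+ k)
coeff*coeff+coeff*coeff≤coeff-⊛ []      q _ _ = z≤n
coeff*coeff+coeff*coeff≤coeff-⊛ (c ∷ p) q {zero} {i′ = suc i′} {k′} _ refl
  rewrite coeff-∷-⊛ c p q (suc i′ ℕ.+ k′) = +-monoʳ-≤ _ (coeff*coeff≤coeff-⊛ p q i′ k′)
coeff*coeff+coeff*coeff≤coeff-⊛ (c ∷ p) q {suc i} {k} (s≤s i<i′) eq
  rewrite coeff-∷-⊛ c p q (suc i ℕ.+ k) =
  ≤-trans (coeff*coeff+coeff*coeff≤coeff-⊛ p q i<i′ (cong pred eq)) (m≤n+m _ _)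

coeff≤coeff-⊛ : ∀ p q {i} k → i ∈supp p → coeff q k ≤ coeff (p ⊛ q) (i ℕ.+ k)
coeff≤coeff-⊛ p q {i} k i∈p = begin
  coeff q k                  ≡⟨ *-identityˡ _ ⟨
  1 * coeff q k              ≤⟨ *-mono-≤ i∈p ≤-refl ⟩
  coeff p i * coeff q k      ≤⟨ coeff*coeff≤coeff-⊛ p q i k ⟩
  coeff (p ⊛ q) (i ℕ.+ k)    ∎
  where open ≤-Reasoning

support-⊛⁻ : ∀ p q {a} → a ∈supp p ⊛ q →
  Σ ℕ λ i → Σ ℕ λ k → i ℕ.+ k ≡ a × i ∈supp p × k ∈supp q
support-⊛⁻ []      q ()
support-⊛⁻ (c ∷ p) q {a} a∈
  with 1≤m+n⇒1≤m⊎1≤n (c * coeff q a) (subst (1 ≤_) (coeff-∷-⊛ c p q a) a∈)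
support-⊛⁻ (c ∷ p) q {a}     a∈ | inj₁ 1≤c*q = 0 , a , refl , 1≤m*n⇒1≤m×1≤n c (coeff q a) 1≤c*q
support-⊛⁻ (c ∷ p) q {zero}  a∈ | inj₂ ()
support-⊛⁻ (c ∷ p) q {suc a} a∈ | inj₂ a∈p⊛q with support-⊛⁻ p q a∈p⊛q
... | i , k , refl , i∈p , k∈q = suc i , k , refl , i∈p , k∈q

2≤coeff-⊛ : ∀ p q {i k i′ k′} → i < i′ → i ℕ.+ k ≡ i′ ℕ.+ k′ →
  i ∈supp p → k ∈supp q → i′ ∈supp p → k′ ∈supp q → 2 ≤ coeff (p ⊛ q) (i ℕ.+ k)
2≤coeff-⊛ p q i<i′ eq i∈p k∈q i′∈p k′∈q =
  ≤-trans (+-mono-≤ (*-mono-≤ i∈p k∈q) (*-mono-≤ i′∈p k′∈q))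
          (coeff*coeff+coeff*coeff≤coeff-⊛ p q i<i′ eq)

support-⊛-unique : ∀ p q {i k i′ k′} → coeff (p ⊛ q) (i ℕ.+ k) ≤ 1 → i ℕ.+ k ≡ i′ ℕ.+ k′ →
  i ∈supp p → k ∈supp q → i′ ∈supp p → k′ ∈supp q → i ≡ i′
support-⊛-unique p q {i} {k} {i′} {k′} ≤1 eq i∈p k∈q i′∈p k′∈q with <-cmp i i′
... | tri≈ _ i≡i′ _ = i≡i′
... | tri< i<i′ _ _ =
  ⊥-elim (<-irrefl refl (≤-trans (2≤coeff-⊛ p q i<i′ eq i∈p k∈q i′∈p k′∈q) ≤1))
... | tri> _ _ i′<i =
  ⊥-elim (<-irrefl refl (≤-trans (2≤coeff-⊛ p q i′<i (sym eq) i′∈p k′∈q i∈p k∈q) ≤1′))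
  where
  ≤1′ : coeff (p ⊛ q) (i′ ℕ.+ k′) ≤ 1
  ≤1′ = subst (λ a → coeff (p ⊛ q) a ≤ 1) eq ≤1

coeff-monomial-self : ∀ k → coeff (monomial k) k ≡ 1
coeff-monomial-self zero    = refl
coeff-monomial-self (suc k) = coeff-monomial-self k

support-monomial⁻ : ∀ k {i} → i ∈supp monomial k → i ≡ k
support-monomial⁻ zero    {zero}  _  = refl
support-monomial⁻ (suc k) {suc i} i∈ = cong suc (support-monomial⁻ k i∈)

support-geomPoly⁻ : ∀ m n {i} → i ∈supp geomPoly m n → Σ ℕ λ t → t < n × i ≡ m * t
support-geomPoly⁻ m (suc n) {i} i∈
  with 1≤m+n⇒1≤m⊎1≤n _ (subst (1 ≤_) (coeff-⊕ (geomPoly m n) (monomial (m * n)) i) i∈)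
... | inj₁ i∈geom with support-geomPoly⁻ m n i∈geom
...   | t , t<n , i≡m*t = t , m≤n⇒m≤1+n t<n , i≡m*t
support-geomPoly⁻ m (suc n) {i} i∈ | inj₂ i∈mono = n , ≤-refl , support-monomial⁻ (m * n) i∈mono

support-geomPoly⁺ : ∀ m n {t} → t < n → m * t ∈supp geomPoly m n
support-geomPoly⁺ m (suc n) {t} t<1+n
  rewrite coeff-⊕ (geomPoly m n) (monomial (m * n)) (m * t) with m≤n⇒m<n∨m≡n (s≤s⁻¹ t<1+n)
... | inj₁ t<n  = ≤-trans (support-geomPoly⁺ m n t<n) (m≤m+n _ _)
... | inj₂ refl = ≤-trans (≤-reflexive (sym (coeff-monomial-self (m * t)))) (m≤n+m _ _)

InBox : ∀ {N} → (Fin N → ℕ) → (Fin N → ℕ) → Set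
InBox n j = ∀ k → j k < n k

dotℕ : (N : ℕ) → (Fin N → ℕ) → (Fin N → ℕ) → ℕ
dotℕ zero    j m = 0
dotℕ (suc N) j m = head m * head j ℕ.+ dotℕ N (tail j) (tail m)

support-APoly⁻ : ∀ N m n {a} → a ∈supp APoly N m n →
  Σ (Fin N → ℕ) λ j → InBox n j × dotℕ N j m ≡ a
support-APoly⁻ zero    m n {zero} _ = (λ ()) , (λ ()) , refl
support-APoly⁻ (suc N) m n a∈
  with support-⊛⁻ (geomPoly (head m) (head n)) (APoly N (tail m) (tail n)) a∈
... | i , k , refl , i∈ , k∈
  with support-geomPoly⁻ (head m) (head n) i∈ | support-APoly⁻ N (tail m) (tail n) k∈
... | t , t<n₀ , refl | j , j<n , refl =
  t Vector.∷ j , (λ { zero → t<n₀ ; (suc k) → j<n k }) , refl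

support-APoly⁺ : ∀ N m n {j} → InBox n j → dotℕ N j m ∈supp APoly N m n
support-APoly⁺ zero    m n j<n = ≤-refl
support-APoly⁺ (suc N) m n j<n =
  ≤-trans (*-mono-≤ (support-geomPoly⁺ (head m) (head n) (j<n zero))
                    (support-APoly⁺ N (tail m) (tail n) (j<n ∘ suc)))
          (coeff*coeff≤coeff-⊛ (geomPoly (head m) (head n)) (APoly N (tail m) (tail n)) _ _)

dotℕ-injective-on-box : ∀ N m n → (∀ i → 1 ≤ m i) → CoeffsAtMostOne (APoly N m n) →
  ∀ {j j′} → InBox n j → InBox n j′ → dotℕ N j m ≡ dotℕ N j′ m → ∀ k → j k ≡ j′ k
dotℕ-injective-on-box zero    m n 1≤m ≤1 j<n j′<n eq ()
dotℕ-injective-on-box (suc N) m n 1≤m ≤1 {j} {j′} j<n j′<n eq =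
  λ { zero → j₀≡j′₀ ; (suc k) → tail-injective k }
  where
  instance
    m₀≢0 : NonZero (head m)
    m₀≢0 = >-nonZero (1≤m zero)
  P Q : Poly
  P = geomPoly (head m) (head n)
  Q = APoly N (tail m) (tail n)
  m₀j₀∈P : head m * head j ∈supp P
  m₀j₀∈P = support-geomPoly⁺ (head m) (head n) (j<n zero)
  m₀j₀≡m₀j′₀ : head m * head j ≡ head m * head j′
  m₀j₀≡m₀j′₀ = support-⊛-unique P Q (≤1 _) eq
    m₀j₀∈P                                          (support-APoly⁺ N (tail m) (tail n) (j<n ∘ suc))
    (support-geomPoly⁺ (head m) (head n) (j′<n zero)) (support-APoly⁺ N (tail m) (tail n) (j′<n ∘ suc))
  j₀≡j′₀ : head j ≡ head j′
  j₀≡j′₀ = *-cancelˡ-≡ _ _ (head m) m₀j₀≡m₀j′₀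
  Q≤1 : CoeffsAtMostOne Q
  Q≤1 a = ≤-trans (coeff≤coeff-⊛ P Q a m₀j₀∈P) (≤1 _)
  πtail-j≡πtail-j′ : dotℕ N (tail j) (tail m) ≡ dotℕ N (tail j′) (tail m)
  πtail-j≡πtail-j′ = +-cancelˡ-≡ (head m * head j) _ _
    (trans eq (cong (ℕ._+ dotℕ N (tail j′) (tail m)) (sym m₀j₀≡m₀j′₀)))
  tail-injective : ∀ k → tail j k ≡ tail j′ k
  tail-injective =
    dotℕ-injective-on-box N (tail m) (tail n) (1≤m ∘ suc) Q≤1 (j<n ∘ suc) (j′<n ∘ suc) πtail-j≡πtail-j′

dot-cong : ∀ N {u v} m → (∀ k → u k ≡ v k) → dot N u m ≡ dot N v m
dot-cong zero    m u≗v = refl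
dot-cong (suc N) m u≗v =
  cong₂ (λ x y → x ℤ.* ℤ.+ head m + y) (u≗v zero) (dot-cong N (tail m) (u≗v ∘ suc))

dot-+ : ∀ N u v m → dot N (λ k → u k + v k) m ≡ dot N u m + dot N v m
dot-+ zero    u v m = refl
dot-+ (suc N) u v m = begin
  (u₀ + v₀) ℤ.* m₀ + dot N (λ k → tail u k + tail v k) (tail m)
    ≡⟨ cong₂ _+_ (ℤ.*-distribʳ-+ m₀ u₀ v₀) (dot-+ N (tail u) (tail v) (tail m)) ⟩
  (u₀ ℤ.* m₀ + v₀ ℤ.* m₀) + (dot N (tail u) (tail m) + dot N (tail v) (tail m))
    ≡⟨ interchange (u₀ ℤ.* m₀) (v₀ ℤ.* m₀) (dot N (tail u) (tail m)) (dot N (tail v) (tail m)) ⟩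
  dot (suc N) u m + dot (suc N) v m ∎
  where
  open ≡-Reasoning
  u₀ v₀ m₀ : ℤ
  u₀ = head u
  v₀ = head v
  m₀ = ℤ.+ head m

dot-pos : ∀ N j m → dot N (λ k → ℤ.+ j k) m ≡ ℤ.+ dotℕ N j m
dot-pos zero    j m = refl
dot-pos (suc N) j m = begin
  ℤ.+ head j ℤ.* ℤ.+ head m + dot N (λ k → ℤ.+ tail j k) (tail m)
    ≡⟨ cong₂ _+_ (sym (ℤ.pos-* (head j) (head m))) (dot-pos N (tail j) (tail m)) ⟩
  ℤ.+ (head j * head m) + ℤ.+ dotℕ N (tail j) (tail m)
    ≡⟨ ℤ.pos-+ (head j * head m) _ ⟨
  ℤ.+ (head j * head m ℕ.+ dotℕ N (tail j) (tail m))
    ≡⟨ cong (λ x → ℤ.+ (x ℕ.+ dotℕ N (tail j) (tail m))) (*-comm (head j) (head m)) ⟩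
  ℤ.+ dotℕ (suc N) j m ∎
  where open ≡-Reasoning

dot-split : ∀ N m {w u v} → (∀ k → w k ≡ u k + v k) → dot N w m ≡ dot N u m + dot N v m
dot-split N m {u = u} {v} w≗u+v = trans (dot-cong N m w≗u+v) (dot-+ N u v m)

dot-+-inW : ∀ N m {w} → inW N m w → ∀ u → dot N (λ k → u k + w k) m ≡ dot N u m
dot-+-inW N m {w} πw≡0 u =
  trans (dot-+ N u w m) (trans (cong (dot N u m +_) πw≡0) (ℤ.+-identityʳ _))

inCalA⇒≡+∣∣ : ∀ N n {u} → inCalA N n u → ∀ k → u k ≡ ℤ.+ ℤ.∣ u k ∣
inCalA⇒≡+∣∣ N n u∈ k = sym (ℤ.0≤i⇒+∣i∣≡i (proj₁ (u∈ k)))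

inCalA⇒InBox : ∀ N n {u} → inCalA N n u → InBox n (λ k → ℤ.∣ u k ∣)
inCalA⇒InBox N n u∈ k = ℤ.drop‿+<+ (subst (ℤ._< ℤ.+ n k) (inCalA⇒≡+∣∣ N n u∈ k) (proj₂ (u∈ k)))

InBox⇒inCalA : ∀ N n {j} → InBox n j → inCalA N n (λ k → ℤ.+ j k)
InBox⇒inCalA N n j<n k = ℤ.+≤+ z≤n , ℤ.+<+ (j<n k)

dot-inCalA : ∀ N m n {u} → inCalA N n u → dot N u m ≡ ℤ.+ dotℕ N (λ k → ℤ.∣ u k ∣) m
dot-inCalA N m n u∈ = trans (dot-cong N m (inCalA⇒≡+∣∣ N n u∈)) (dot-pos N _ m)

dot-inCalA⇒inA : ∀ N m n → CoeffsAtMostOne (APoly N m n) →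
  ∀ {u} → inCalA N n u → inA N m n (dot N u m)
dot-inCalA⇒inA N m n ≤1 u∈ =
  _ , dot-inCalA N m n u∈ , ≤-antisym (≤1 _) (support-APoly⁺ N m n (inCalA⇒InBox N n u∈))

inA⇒dot-inCalA : ∀ N m n {a} → inA N m n a → Σ (Fin N → ℤ) λ u → inCalA N n u × dot N u m ≡ a
inA⇒dot-inCalA N m n (a , refl , coeff≡1) with support-APoly⁻ N m n (≤-reflexive (sym coeff≡1))
... | j , j<n , refl = (λ k → ℤ.+ j k) , InBox⇒inCalA N n j<n , dot-pos N j m

dot-injective-on-inCalA : ∀ N m n → (∀ i → 1 ≤ m i) → CoeffsAtMostOne (APoly N m n) →
  ∀ {u u′} → inCalA N n u → inCalA N n u′ → dot N u m ≡ dot N u′ m → ∀ k → u k ≡ u′ k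
dot-injective-on-inCalA N m n 1≤m ≤1 {u} {u′} u∈ u′∈ πu≡πu′ k = begin
  u k              ≡⟨ inCalA⇒≡+∣∣ N n u∈ k ⟩
  ℤ.+ ℤ.∣ u k ∣    ≡⟨ cong ℤ.+_ ∣uₖ∣≡∣u′ₖ∣ ⟩
  ℤ.+ ℤ.∣ u′ k ∣   ≡⟨ inCalA⇒≡+∣∣ N n u′∈ k ⟨
  u′ k             ∎
  where
  open ≡-Reasoning
  πℕ∣u∣≡πℕ∣u′∣ : dotℕ N (λ k → ℤ.∣ u k ∣) m ≡ dotℕ N (λ k → ℤ.∣ u′ k ∣) m
  πℕ∣u∣≡πℕ∣u′∣ =
    ℤ.+-injective (trans (sym (dot-inCalA N m n u∈)) (trans πu≡πu′ (dot-inCalA N m n u′∈)))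
  ∣uₖ∣≡∣u′ₖ∣ : ℤ.∣ u k ∣ ≡ ℤ.∣ u′ k ∣
  ∣uₖ∣≡∣u′ₖ∣ =
    dotℕ-injective-on-box N m n 1≤m ≤1 (inCalA⇒InBox N n u∈) (inCalA⇒InBox N n u′∈) πℕ∣u∣≡πℕ∣u′∣ k

Exhaustive : (ℤ → Set) → (ℤ → Set) → Set
Exhaustive A B = ∀ z → Σ ℤ (λ a → Σ ℤ (λ b → A a × B b × (z ≡ a + b)))

Unambiguous : (ℤ → Set) → (ℤ → Set) → Set
Unambiguous A B =
  ∀ z a b a′ b′ → A a → B b → z ≡ a + b → A a′ → B b′ → z ≡ a′ + b′ → (a ≡ a′) × (b ≡ b′)

calA+calB-exhaustive : ∀ N m n B → Exhaustive (inA N m n) B → ∀ w →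
  Σ (Fin N → ℤ) λ u → Σ (Fin N → ℤ) λ v → inCalA N n u × inCalB N m B v × (∀ k → w k ≡ u k + v k)
calA+calB-exhaustive N m n B A+B w with A+B (dot N w m)
... | a , b , a∈A , b∈B , πw≡a+b with inA⇒dot-inCalA N m n a∈A
...   | u , u∈ , πu≡a = u , v , u∈ , subst B b≡πv b∈B , w≗u+v
  where
  open ≡-Reasoning
  v : Fin N → ℤ
  v k = ℤ.- u k + w k
  w≗u+v : ∀ k → w k ≡ u k + v k
  w≗u+v k = sym (\\-leftDividesˡ (u k) (w k))
  b≡πv : b ≡ dot N v m
  b≡πv = ∙-cancelˡ a b (dot N v m) (begin
    a + b                   ≡⟨ πw≡a+b ⟨
    dot N w m               ≡⟨ dot-split N m w≗u+v ⟩
    dot N u m + dot N v m   ≡⟨ cong (_+ dot N v m) πu≡a ⟩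
    a + dot N v m           ∎)

calA+calB-unambiguous : ∀ N m n → (∀ i → 1 ≤ m i) → CoeffsAtMostOne (APoly N m n) →
  ∀ B → Unambiguous (inA N m n) B →
  ∀ (w u v u′ v′ : Fin N → ℤ) → inCalA N n u → inCalB N m B v → (∀ k → w k ≡ u k + v k)
  → inCalA N n u′ → inCalB N m B v′ → (∀ k → w k ≡ u′ k + v′ k)
  → (∀ k → u k ≡ u′ k) × (∀ k → v k ≡ v′ k)
calA+calB-unambiguous N m n 1≤m ≤1 B A+B-unique w u v u′ v′ u∈ v∈ w≗u+v u′∈ v′∈ w≗u′+v′ =
  u≗u′ , v≗v′
  where
  πu≡πu′ : dot N u m ≡ dot N u′ m
  πu≡πu′ = proj₁ (A+B-unique (dot N w m) _ _ _ _
    (dot-inCalA⇒inA N m n ≤1 u∈) v∈ (dot-split N m w≗u+v)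
    (dot-inCalA⇒inA N m n ≤1 u′∈) v′∈ (dot-split N m w≗u′+v′))
  u≗u′ : ∀ k → u k ≡ u′ k
  u≗u′ = dot-injective-on-inCalA N m n 1≤m ≤1 u∈ u′∈ πu≡πu′
  v≗v′ : ∀ k → v k ≡ v′ k
  v≗v′ k = ∙-cancelˡ (u k) (v k) (v′ k)
    (trans (sym (w≗u+v k)) (trans (w≗u′+v′ k) (cong (_+ v′ k) (sym (u≗u′ k)))))

lemma4p1 : (N : ℕ) → 1 ≤ N → (m n : Fin N → ℕ) → (∀ i → 1 ≤ m i) → (∀ i → 1 ≤ n i)
  → (∀ a → (coeff (APoly N m n) a ≡ 0) ⊎ (coeff (APoly N m n) a ≡ 1))
  → (B : ℤ → Set)
  → (∀ z → Σ ℤ (λ a → Σ ℤ (λ b → inA N m n a × B b × (z ≡ a + b))))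
  → (∀ z a b a′ b′ → inA N m n a → B b → z ≡ a + b → inA N m n a′ → B b′ → z ≡ a′ + b′ → (a ≡ a′) × (b ≡ b′))
  → ((∀ (w : Fin N → ℤ) → Σ (Fin N → ℤ) (λ u → Σ (Fin N → ℤ) (λ v → inCalA N n u × inCalB N m B v × (∀ k → w k ≡ u k + v k))))
     × (∀ (w u v u′ v′ : Fin N → ℤ) → inCalA N n u → inCalB N m B v → (∀ k → w k ≡ u k + v k)
         → inCalA N n u′ → inCalB N m B v′ → (∀ k → w k ≡ u′ k + v′ k)
         → (∀ k → u k ≡ u′ k) × (∀ k → v k ≡ v′ k)))
    × (∀ (w : Fin N → ℤ) → inW N m w → ∀ (u : Fin N → ℤ)
         → (inCalB N m B u → inCalB N m B (λ k → u k + w k)) × (inCalB N m B (λ k → u k + w k) → inCalB N m B u))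
lemma4p1 N _ m n 1≤m _ coeffs∈01 B A+B A+B-unique =
  (calA+calB-exhaustive N m n B A+B , calA+calB-unambiguous N m n 1≤m coeffs≤1 B A+B-unique) ,
  λ w w∈W u → subst B (sym (dot-+-inW N m w∈W u)) , subst B (dot-+-inW N m w∈W u)
  where
  coeffs≤1 : CoeffsAtMostOne (APoly N m n)
  coeffs≤1 a with coeffs∈01 a
  ... | inj₁ coeff≡0 = ≤-trans (≤-reflexive coeff≡0) z≤n
  ... | inj₂ coeff≡1 = ≤-reflexive coeff≡1
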